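{- Let $G=(S_1,S_2,E,w)$ be a game with largest absolute weight $W$, $s_{init}\in S$, $U\in\mathbb{N}$ and $t\in\mathbb{Q}$. Define the game $G'=(S'_1,S'_2,E',w')$ by $S'_1=(S_1\times\{0,\dots,U\})\cup\{\mathsf{sink}\}$, $S'_2=S_2\times\{0,\dots,U\}$, and for every $(u,v)\in E$ and $c\in\{0,\dots,U\}$: if $d=c+w(u,v)\in[0,U]$ then $((u,c),(v,d))\in E'$ with weight $w(u,v)$, otherwise $((u,c),\mathsf{sink})\in E'$ with weight $1$; finally $(\mathsf{sink},\mathsf{sink})\in E'$ with weight $1$. Then $|S'|=(U+1)\cdot|S|+1$, the largest absolute weight of $G'$ is at most $\max\{\min\{W,U\},1\}$, and player 1 has a winning strategy from $s_{init}$ in $G$ for $\mathrm{LowerUpper}(U,0)\cap\mathrm{AvgEnergy}(t)$ if and only if player 1 has a winning strategy from $(s_{init},0)$ in $G'$ for $\mathrm{AvgEnergy}(t)$.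
   Context: A game is a tuple $G=(S_1,S_2,E,w)$ where $S_1,S_2$ are disjoint finite sets of states (of player 1 and player 2), $S=S_1\uplus S_2$, $E\subseteq S\times S$ is a set of edges with every state having a successor, and $w\colon E\to\mathbb{Z}$. A play from $s_{init}$ is $\pi=s_0s_1\dots$ with $s_0=s_{init}$ and $(s_i,s_{i+1})\in E$; $\pi(n)=s_0\dots s_n$; $\mathrm{EL}(\pi(n))=\sum_{i=0}^{n-1}w(s_i,s_{i+1})$; $\overline{\mathrm{AE}}(\pi)=\limsup_n\frac1n\sum_{i=1}^n\mathrm{EL}(\pi(i))$. A strategy of player $i$ maps each finite prefix ending in $S_i$ to a successor of its last state; a strategy of player 1 is winning from $s_{init}$ for objective $\mathcal{W}$ if all consistent plays from $s_{init}$ lie in $\mathcal{W}$. $\mathrm{AvgEnergy}(t)=\{\pi\mid\overline{\mathrm{AE}}(\pi)\le t\}$; $\mathrm{LowerUpper}(U,c_{init})=\{\pi\mid\forall n\ge0,\ c_{init}+\mathrm{EL}(\pi(n))\in[0,U]\}$. -}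

module Defs where

open import Data.Nat as ℕ using (ℕ; zero; suc; s≤s; _≤?_)
open import Data.Nat.Properties using (≤-refl)
open import Data.Integer as ℤ using (ℤ; +_; -[1+_])
open import Data.Rational as ℚ using (ℚ)
open import Data.Fin using (Fin; toℕ; fromℕ<)
open import Data.Fin.Properties using (toℕ-fromℕ<)
open import Data.Sum using (_⊎_; inj₁; inj₂)
open import Data.Product using (Σ; ∃; _×_; _,_; proj₁)
open import Data.Unit using (⊤; tt)
open import Data.Empty using (⊥)
open import Data.List using (List; map; upTo)
open import Relation.Nullary using (¬_; yes; no)
open import Relation.Binary.PropositionalEquality using (_≡_; refl; sym; cong)

-- The weight function w is given on all pairs of states; only its values
-- on edges matter.  Finiteness of the state set is assumed separately
-- (as a bijection with Fin n) where needed.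

record Game : Set₁ where
  field
    S₁ S₂ : Set
    E     : S₁ ⊎ S₂ → S₁ ⊎ S₂ → Set
    w     : S₁ ⊎ S₂ → S₁ ⊎ S₂ → ℤ
    total : ∀ s → ∃ λ s' → E s s'

open Game public

State : Game → Set
State G = S₁ G ⊎ S₂ G

IsLargestAbsWeight : Game → ℕ → Set
IsLargestAbsWeight G W =
  (∀ u v → E G u v → ℤ.∣ w G u v ∣ ℕ.≤ W) ×
  (Σ (State G) λ u → Σ (State G) λ v → E G u v × (ℤ.∣ w G u v ∣ ≡ W))

Play : Game → Set
Play G = ℕ → State G

-- π(0) … π(i-1): the states before position i (the prefix π(i) is this
-- list followed by the last state π i).
before : ∀ {G} → Play G → ℕ → List (State G)
before π i = map π (upTo i)

-- A strategy of player 1 maps a finite prefix (earlier states, last state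
-- in S₁) to a successor of the last state.
Strategy₁ : Game → Set
Strategy₁ G = List (State G) → (s : S₁ G) → Σ (State G) λ s' → E G (inj₁ s) s'

IsPlayFrom : (G : Game) → State G → Play G → Set
IsPlayFrom G s π = (π 0 ≡ s) × (∀ i → E G (π i) (π (suc i)))

ConsistentWith : (G : Game) → Strategy₁ G → Play G → Set
ConsistentWith G σ π =
  ∀ i (s : S₁ G) → π i ≡ inj₁ s → π (suc i) ≡ proj₁ (σ (before {G} π i) s)

Objective : Game → Set₁
Objective G = Play G → Set

WinsFrom : (G : Game) → State G → Objective G → Set
WinsFrom G s 𝒲 =
  Σ (Strategy₁ G) λ σ → ∀ π → IsPlayFrom G s π → ConsistentWith G σ π → 𝒲 π

EL : (G : Game) → Play G → ℕ → ℤ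
EL G π zero    = + 0
EL G π (suc n) = EL G π n ℤ.+ w G (π n) (π (suc n))

sumEL : (G : Game) → Play G → ℕ → ℤ
sumEL G π zero    = + 0
sumEL G π (suc n) = sumEL G π n ℤ.+ EL G π (suc n)

-- avgEL G π m = (1/n) Σ_{i=1}^{n} EL(π(i))  with n = m + 1
avgEL : (G : Game) → Play G → ℕ → ℚ
avgEL G π m = sumEL G π (suc m) ℚ./ suc m

-- limsup of a rational sequence is ≤ t  (in the extended reals):
-- for every ε > 0, eventually a m ≤ t + ε.
LimsupLE : (ℕ → ℚ) → ℚ → Set
LimsupLE a t = ∀ (ε : ℚ) → ℚ.0ℚ ℚ.< ε → ∃ λ N → ∀ m → N ℕ.≤ m → a m ℚ.≤ t ℚ.+ ε

AvgEnergy : (G : Game) → ℚ → Objective G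
AvgEnergy G t π = LimsupLE (avgEL G π) t

LowerUpper : (G : Game) → ℕ → ℤ → Objective G
LowerUpper G U cinit π =
  ∀ n → (+ 0 ℤ.≤ cinit ℤ.+ EL G π n) × (cinit ℤ.+ EL G π n ℤ.≤ + U)

_∩_ : ∀ {G} → Objective G → Objective G → Objective G
(A ∩ B) π = A π × B π

module Product (G : Game) (U : ℕ) where

  S₁' : Set
  S₁' = (S₁ G × Fin (suc U)) ⊎ ⊤      -- inj₂ tt is the sink

  S₂' : Set
  S₂' = S₂ G × Fin (suc U)

  State' : Set
  State' = S₁' ⊎ S₂'

  pair : State G → Fin (suc U) → State'
  pair (inj₁ s) c = inj₁ (inj₁ (s , c))
  pair (inj₂ s) c = inj₂ (s , c)

  sink : State'
  sink = inj₁ (inj₂ tt)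

  InRange : ℤ → Set
  InRange d = (+ 0 ℤ.≤ d) × (d ℤ.≤ + U)

  data E' : State' → State' → Set where
    step   : ∀ {u v} (c d : Fin (suc U)) → E G u v →
             + toℕ d ≡ + toℕ c ℤ.+ w G u v → E' (pair u c) (pair v d)
    toSink : ∀ {u v} (c : Fin (suc U)) → E G u v →
             ¬ InRange (+ toℕ c ℤ.+ w G u v) → E' (pair u c) sink
    loop   : E' sink sink

  w' : State' → State' → ℤ
  w' (inj₁ (inj₂ tt)) (inj₁ (inj₂ tt)) = + 1
  w' (inj₁ (inj₁ (u , c))) (inj₁ (inj₂ tt)) = + 1
  w' (inj₂ (u , c)) (inj₁ (inj₂ tt)) = + 1
  w' (inj₁ (inj₁ (u , c))) (inj₁ (inj₁ (v , d))) = w G (inj₁ u) (inj₁ v)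
  w' (inj₁ (inj₁ (u , c))) (inj₂ (v , d)) = w G (inj₁ u) (inj₂ v)
  w' (inj₂ (u , c)) (inj₁ (inj₁ (v , d))) = w G (inj₂ u) (inj₁ v)
  w' (inj₂ (u , c)) (inj₂ (v , d)) = w G (inj₂ u) (inj₂ v)
  w' (inj₁ (inj₂ tt)) _ = + 0   -- not an edge

  private
    succ : ∀ u v (c : Fin (suc U)) → E G u v → (x : ℤ) →
           x ≡ + toℕ c ℤ.+ w G u v → ∃ λ s' → E' (pair u c) s'
    succ u v c e (+ k) eq with k ≤? U
    ... | yes k≤U = pair v (fromℕ< (s≤s k≤U)) ,
                    step c _ e (Relation.Binary.PropositionalEquality.trans
                                 (cong +_ (toℕ-fromℕ< (s≤s k≤U))) eq)
    ... | no k≰U = sink , toSink c e λ r → k≰U (ℤ.drop‿+≤+ (Relation.Binary.PropositionalEquality.subst (ℤ._≤ + U) (sym eq) (Data.Product.proj₂ r)))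
    succ u v c e -[1+ k ] eq = sink , toSink c e λ r → neg (Relation.Binary.PropositionalEquality.subst (+ 0 ℤ.≤_) (sym eq) (proj₁ r))
      where
        neg : ¬ (+ 0 ℤ.≤ -[1+ k ])
        neg ()

  total' : ∀ s → ∃ λ s' → E' s s'
  total' (inj₁ (inj₂ tt)) = sink , loop
  total' (inj₁ (inj₁ (u , c))) with total G (inj₁ u)
  ... | v , e = succ (inj₁ u) v c e _ refl
  total' (inj₂ (u , c)) with total G (inj₂ u)
  ... | v , e = succ (inj₂ u) v c e _ refl

  G' : Game
  G' = record { S₁ = S₁' ; S₂ = S₂' ; E = E' ; w = w' ; total = total' }

module Submission where

-- G' runs G with the current energy level as a counter and falls into a sink, whose weight-1
-- self-loop drives the average energy to infinity, as soon as the level would leave [0, U].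
-- A strategy winning in G for LowerUpper ∩ AvgEnergy never makes or allows a move leaving
-- [0, U]: the offending prefix, extended to a full consistent play, would violate LowerUpper.
-- So it is replayed in G' with the same energy levels. Conversely, a strategy winning in G' is
-- simulated in G by recomputing the counters from the history; the simulated play of G' has
-- finite average energy, so it never reaches the sink, and its counter is the energy level.

open import Defs
open import Data.Nat using (ℕ; suc; _+_; _*_; _≤_; _⊔_; _⊓_)
open import Data.Integer using (∣_∣; 0ℤ)
open import Data.Rational using (ℚ)
open import Data.Fin using (Fin; zero)
open import Data.Product using (_×_)
open import Function.Bundles using (_↔_; _⇔_)

open import Data.Nat using (zero; s≤s; z≤n; _<_; _≤?_; _<?_)
import Data.Nat.Properties as ℕP
import Data.Nat.Tactic.RingSolver as ℕ-Ring
open import Data.Integer as ℤ using (ℤ; +_; -[1+_]; 1ℤ)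
import Data.Integer.Properties as ℤP
import Data.Integer.Tactic.RingSolver as ℤ-Ring
import Data.Rational as ℚ
import Data.Rational.Properties as ℚP
import Data.Rational.Unnormalised as ℚᵘ
import Data.Rational.Unnormalised.Properties as ℚᵘP
open import Data.Fin using (toℕ; fromℕ<)
open import Data.Fin.Properties using (toℕ-fromℕ<; fromℕ<-toℕ; toℕ<n; +↔⊎; *↔×; 1↔⊤)
open import Data.Sum using (_⊎_; inj₁; inj₂)
open import Data.Product using (Σ; _,_; proj₁; proj₂; uncurry)
open import Data.Unit using (⊤; tt)
open import Data.Empty using (⊥-elim)
open import Data.Maybe using (Maybe; just; nothing)
open import Data.List using (List; []; _∷_; _∷ʳ_; map; upTo; foldl)
import Data.List.Properties as ListP
open import Relation.Nullary using (¬_; Dec; yes; no)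
open import Relation.Binary.PropositionalEquality
open import Function.Bundles using (mk↔ₛ′; mk⇔)
open import Function.Properties.Inverse using (↔-trans; ↔-sym; ↔-refl)
open import Data.Sum.Function.Propositional using (_⊎-↔_)
open import Data.Product.Function.NonDependent.Propositional using (_×-↔_)

map-upTo-suc : ∀ {A : Set} (f : ℕ → A) n → map f (upTo (suc n)) ≡ map f (upTo n) ∷ʳ f n
map-upTo-suc f n = trans (cong (map f) (sym (ListP.upTo-∷ʳ n))) (ListP.map-++ f (upTo n) (n ∷ []))

map-upTo-cong : ∀ {A : Set} {f g : ℕ → A} n → (∀ j → j < n → f j ≡ g j) →
                map f (upTo n) ≡ map g (upTo n)
map-upTo-cong zero    f≗g = refl
map-upTo-cong {f = f} {g} (suc n) f≗g = begin
  map f (upTo (suc n))      ≡⟨ map-upTo-suc f n ⟩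
  map f (upTo n) ∷ʳ f n     ≡⟨ cong₂ _∷ʳ_ (map-upTo-cong n (λ j j<n → f≗g j (ℕP.m<n⇒m<1+n j<n)))
                                          (f≗g n ℕP.≤-refl) ⟩
  map g (upTo n) ∷ʳ g n     ≡⟨ map-upTo-suc g n ⟨
  map g (upTo (suc n))      ∎
  where open ≡-Reasoning

splice : ∀ {A : Set} → (ℕ → A) → ℕ → A → ℕ → A
splice f zero    a zero    = f zero
splice f zero    a (suc j) = a
splice f (suc n) a zero    = f zero
splice f (suc n) a (suc j) = splice (λ i → f (suc i)) n a j

splice-≤ : ∀ {A : Set} (f : ℕ → A) {n} a {j} → j ≤ n → splice f n a j ≡ f j
splice-≤ f {zero}  a {zero}  _         = refl
splice-≤ f {suc n} a {zero}  _         = refl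
splice-≤ f {suc n} a {suc j} (s≤s j≤n) = splice-≤ (λ i → f (suc i)) a j≤n

splice-suc : ∀ {A : Set} (f : ℕ → A) n a → splice f n a (suc n) ≡ a
splice-suc f zero    a = refl
splice-suc f (suc n) a = splice-suc (λ i → f (suc i)) n a

extend-below : ∀ {P : ℕ → Set} {n} → (∀ j → j < n → P j) → P n → ∀ j → j < suc n → P j
extend-below below at-n j j<1+n with ℕP.m<1+n⇒m<n∨m≡n j<1+n
... | inj₁ j<n  = below j j<n
... | inj₂ refl = at-n

EL-cong : ∀ G {π ρ : Play G} n → (∀ j → j ≤ n → π j ≡ ρ j) → EL G π n ≡ EL G ρ n
EL-cong G zero    π≗ρ = refl
EL-cong G (suc n) π≗ρ = cong₂ ℤ._+_ (EL-cong G n (λ j j≤n → π≗ρ j (ℕP.m≤n⇒m≤1+n j≤n)))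
                                    (cong₂ (w G) (π≗ρ n (ℕP.n≤1+n n)) (π≗ρ (suc n) ℕP.≤-refl))

AvgEnergy-cong : ∀ {G H} {π : Play G} {ρ : Play H} t → (∀ n → EL G π n ≡ EL H ρ n) →
                 AvgEnergy G t π → AvgEnergy H t ρ
AvgEnergy-cong {G} {H} {π} {ρ} t EL≗ avg ε ε>0 with avg ε ε>0
... | N , bounded =
  N , λ m N≤m → subst (ℚ._≤ t ℚ.+ ε) (cong (ℚ._/ suc m) (sumEL-cong (suc m))) (bounded m N≤m)
  where
  sumEL-cong : ∀ n → sumEL G π n ≡ sumEL H ρ n
  sumEL-cong zero    = refl
  sumEL-cong (suc n) = cong₂ ℤ._+_ (sumEL-cong n) (EL≗ (suc n))

i≤+∣i∣ : ∀ i → i ℤ.≤ + ∣ i ∣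
i≤+∣i∣ (+ n)    = ℤP.≤-refl
i≤+∣i∣ -[1+ n ] = ℤ.-≤+

0≤i+∣i∣ : ∀ i → 0ℤ ℤ.≤ i ℤ.+ + ∣ i ∣
0≤i+∣i∣ (+ n)    = ℤ.+≤+ z≤n
0≤i+∣i∣ -[1+ n ] = ℤP.≤-reflexive (sym (ℤP.n⊖n≡0 (suc n)))

/-≤⇒≤ : ∀ p m q → p ℚ./ suc m ℚ.≤ q → p ℤ.≤ + ∣ ℚ.↥ q ∣ ℤ.* + suc m
/-≤⇒≤ -[1+ k ] m q _ = ℤP.≤-trans ℤ.-≤+ (ℤP.≤-reflexive (ℤP.pos-* ∣ ℚ.↥ q ∣ (suc m)))
/-≤⇒≤ (+ k) m q@record{} p/m≤q = begin
  + k                      ≡⟨ ℤP.*-identityʳ (+ k) ⟨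
  + k ℤ.* 1ℤ               ≤⟨ ℤP.*-monoˡ-≤-nonNeg (+ k) (ℤ.+≤+ (s≤s z≤n)) ⟩
  + k ℤ.* ℚ.↧ q            ≤⟨ cross ⟩
  ℚ.↥ q ℤ.* + suc m        ≤⟨ ℤP.*-monoʳ-≤-nonNeg (+ suc m) (i≤+∣i∣ (ℚ.↥ q)) ⟩
  + ∣ ℚ.↥ q ∣ ℤ.* + suc m  ∎
  where
  open ℤP.≤-Reasoning
  cross : + k ℤ.* ℚ.↧ q ℤ.≤ ℚ.↥ q ℤ.* + suc m
  cross = ℚᵘP.drop-*≤* (ℚᵘP.≤-respˡ-≃ (ℚP.toℚᵘ-fromℚᵘ (ℚᵘ.mkℚᵘ (+ k) m))
                                      (ℚP.toℚᵘ-mono-≤ p/m≤q))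

linear-growth : (x : ℕ → ℤ) (k : ℕ) (c : ℤ) →
                (∀ j → x (k + j) ℤ.+ c ℤ.≤ x (suc (k + j))) →
                ∀ j → x k ℤ.+ + j ℤ.* c ℤ.≤ x (k + j)
linear-growth x k c step zero = ℤP.≤-reflexive (begin
  x k ℤ.+ 0ℤ ℤ.* c  ≡⟨ ℤP.+-identityʳ (x k) ⟩
  x k               ≡⟨ cong x (ℕP.+-identityʳ k) ⟨
  x (k + 0)         ∎)
  where open ≡-Reasoning
linear-growth x k c step (suc j) = begin
  x k ℤ.+ + suc j ℤ.* c        ≡⟨ expand (x k) (+ j) c ⟩
  (x k ℤ.+ + j ℤ.* c) ℤ.+ c    ≤⟨ ℤP.+-monoˡ-≤ c (linear-growth x k c step j) ⟩
  x (k + j) ℤ.+ c              ≤⟨ step j ⟩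
  x (suc (k + j))              ≡⟨ cong x (ℕP.+-suc k j) ⟨
  x (k + suc j)                ∎
  where
  open ℤP.≤-Reasoning
  expand : ∀ a i d → a ℤ.+ (1ℤ ℤ.+ i) ℤ.* d ≡ (a ℤ.+ i ℤ.* d) ℤ.+ d
  expand = ℤ-Ring.solve-∀

EL-increasing⇒¬AvgEnergy : ∀ G (π : Play G) t k →
  (∀ j → EL G π (k + j) ℤ.+ 1ℤ ℤ.≤ EL G π (suc (k + j))) →
  ¬ AvgEnergy G t π
EL-increasing⇒¬AvgEnergy G π t k increasing avg = ℤP.<-irrefl refl (begin-strict
  + B ℤ.* + suc m              <⟨ beyond-bound ⟩
  S ℤ.+ + suc i ℤ.* + suc B    ≤⟨ sum-growth (suc i) ⟩
  sumEL G π (K + suc i)        ≡⟨ cong (sumEL G π) (ℕP.+-suc K i) ⟩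
  sumEL G π (suc m)            ≤⟨ sum-bounded m N≤m ⟩
  + B ℤ.* + suc m              ∎)
  where
  open ℤP.≤-Reasoning
  0<1 : ℚ.0ℚ ℚ.< ℚ.1ℚ
  0<1 = ℚ.*<* (ℤ.+<+ (s≤s z≤n))
  N B : ℕ
  N = proj₁ (avg ℚ.1ℚ 0<1)
  B = ∣ ℚ.↥ (t ℚ.+ ℚ.1ℚ) ∣
  sum-bounded : ∀ m → N ≤ m → sumEL G π (suc m) ℤ.≤ + B ℤ.* + suc m
  sum-bounded m N≤m = /-≤⇒≤ _ m _ (proj₂ (avg ℚ.1ℚ 0<1) m N≤m)
  -- From K on, every energy level exceeds B, so the sums grow with slope B + 1.
  K : ℕ
  K = k + (∣ EL G π k ∣ + B)
  EL-large : ∀ i → + suc B ℤ.≤ EL G π (suc (K + i))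
  EL-large i = begin
    + suc B                                               ≤⟨ ℤ.+≤+ (s≤s (ℕP.m≤m+n B i)) ⟩
    + suc (B + i)                                         ≡⟨ ℤP.+-identityˡ _ ⟨
    0ℤ ℤ.+ + suc (B + i)                                  ≤⟨ ℤP.+-monoˡ-≤ _ (0≤i+∣i∣ (EL G π k)) ⟩
    EL G π k ℤ.+ + ∣ EL G π k ∣ ℤ.+ + suc (B + i)         ≡⟨ ℤP.+-assoc (EL G π k) _ _ ⟩
    EL G π k ℤ.+ + j                                      ≡⟨ cong (λ z → EL G π k ℤ.+ z) (ℤP.*-identityʳ (+ j)) ⟨
    EL G π k ℤ.+ + j ℤ.* 1ℤ                               ≤⟨ linear-growth (EL G π) k 1ℤ increasing j ⟩
    EL G π (k + j)                                        ≡⟨ cong (EL G π) (rearrange k ∣ EL G π k ∣ B i) ⟩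
    EL G π (suc (K + i))                                  ∎
    where
    j : ℕ
    j = ∣ EL G π k ∣ + suc (B + i)
    rearrange : ∀ k a b i → k + (a + suc (b + i)) ≡ suc (k + (a + b) + i)
    rearrange = ℕ-Ring.solve-∀
  S : ℤ
  S = sumEL G π K
  sum-growth : ∀ i → S ℤ.+ + i ℤ.* + suc B ℤ.≤ sumEL G π (K + i)
  sum-growth = linear-growth (sumEL G π) K (+ suc B) λ i → ℤP.+-monoʳ-≤ (sumEL G π (K + i)) (EL-large i)
  i m : ℕ
  i = N + (B * K + ∣ S ∣)
  m = K + i
  N≤m : N ≤ m
  N≤m = ℕP.≤-trans (ℕP.m≤m+n N _) (ℕP.m≤n+m i K)
  +i≡ : + i ≡ + N ℤ.+ (+ B ℤ.* + K ℤ.+ + ∣ S ∣)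
  +i≡ = cong (λ BK → + N ℤ.+ (BK ℤ.+ + ∣ S ∣)) (ℤP.pos-* B K)
  beyond-bound : + B ℤ.* + suc m ℤ.< S ℤ.+ + suc i ℤ.* + suc B
  beyond-bound = begin-strict
    + B ℤ.* + suc m                                  ≡⟨ ℤP.+-identityˡ _ ⟨
    0ℤ ℤ.+ + B ℤ.* + suc m                           <⟨ ℤP.+-monoˡ-< (+ B ℤ.* + suc m) (ℤ.+<+ (s≤s z≤n)) ⟩
    + suc N ℤ.+ + B ℤ.* + suc m                      ≡⟨ ℤP.+-identityˡ _ ⟨
    0ℤ ℤ.+ (+ suc N ℤ.+ + B ℤ.* + suc m)             ≤⟨ ℤP.+-monoˡ-≤ _ (0≤i+∣i∣ S) ⟩
    S ℤ.+ + ∣ S ∣ ℤ.+ (+ suc N ℤ.+ + B ℤ.* + suc m)  ≡⟨ rearrange (+ i) +i≡ ⟩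
    S ℤ.+ + suc i ℤ.* + suc B                        ∎
    where
    expand : ∀ s a n b k →
             s ℤ.+ a ℤ.+ ((1ℤ ℤ.+ n) ℤ.+ b ℤ.* (1ℤ ℤ.+ (k ℤ.+ (n ℤ.+ (b ℤ.* k ℤ.+ a))))) ≡
             s ℤ.+ (1ℤ ℤ.+ (n ℤ.+ (b ℤ.* k ℤ.+ a))) ℤ.* (1ℤ ℤ.+ b)
    expand = ℤ-Ring.solve-∀
    rearrange : ∀ x → x ≡ + N ℤ.+ (+ B ℤ.* + K ℤ.+ + ∣ S ∣) →
                S ℤ.+ + ∣ S ∣ ℤ.+ (+ suc N ℤ.+ + B ℤ.* (1ℤ ℤ.+ (+ K ℤ.+ x))) ≡
                S ℤ.+ (1ℤ ℤ.+ x) ℤ.* + suc B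
    rearrange _ refl = expand S (+ ∣ S ∣) (+ N) (+ B) (+ K)

ConsistentMove : (G : Game) → Strategy₁ G → List (State G) → State G → State G → Set
ConsistentMove G σ h u v = E G u v × (∀ s → u ≡ inj₁ s → v ≡ proj₁ (σ h s))

ConsistentStep : (G : Game) → Strategy₁ G → Play G → ℕ → Set
ConsistentStep G σ π j = ConsistentMove G σ (before {G} π j) (π j) (π (suc j))

module _ {G : Game} {σ : Strategy₁ G} where

  ConsistentMove-cong : ∀ {h h' u u' v v'} → h ≡ h' → u ≡ u' → v ≡ v' →
                        ConsistentMove G σ h u v → ConsistentMove G σ h' u' v'
  ConsistentMove-cong refl refl refl move = move

  ConsistentStep-cong : ∀ {π ρ : Play G} j → (∀ l → l ≤ suc j → π l ≡ ρ l) →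
                        ConsistentStep G σ π j → ConsistentStep G σ ρ j
  ConsistentStep-cong j π≗ρ = ConsistentMove-cong
    (map-upTo-cong j (λ l l<j → π≗ρ l (ℕP.m≤n⇒m≤1+n (ℕP.<⇒≤ l<j))))
    (π≗ρ j (ℕP.n≤1+n j))
    (π≗ρ (suc j) ℕP.≤-refl)

  consistent-play : ∀ {s} {π : Play G} → π 0 ≡ s → (∀ j → ConsistentStep G σ π j) →
                    IsPlayFrom G s π × ConsistentWith G σ π
  consistent-play π₀ steps = (π₀ , λ j → proj₁ (steps j)) , λ j → proj₂ (steps j)

  respond : List (State G) → (u : State G) → Σ (State G) (E G u)
  respond h (inj₁ s) = σ h s
  respond h (inj₂ s) = total G (inj₂ s)

  respond-consistent : ∀ h u → ConsistentMove G σ h u (proj₁ (respond h u))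
  respond-consistent h (inj₁ s) = proj₂ (σ h s) , λ { _ refl → refl }
  respond-consistent h (inj₂ s) = proj₂ (total G (inj₂ s)) , λ _ ()

  extend-prefix : (f : Play G) (K : ℕ) → (∀ j → j < K → ConsistentStep G σ f j) →
                  Σ (Play G) λ ρ → (∀ j → j ≤ K → ρ j ≡ f j) × (∀ j → ConsistentStep G σ ρ j)
  extend-prefix f K prefix = ρ , agrees , steps
    where
    next : ℕ → List (State G) → State G → State G
    next j h u with j <? K
    ... | yes _ = f (suc j)
    ... | no _  = proj₁ (respond h u)

    next-≮ : ∀ {j} h u → ¬ j < K → next j h u ≡ proj₁ (respond h u)
    next-≮ {j} h u j≮K with j <? K
    ... | yes j<K = ⊥-elim (j≮K j<K)
    ... | no _    = refl

    grow : ℕ → List (State G) × State G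
    grow zero    = [] , f 0
    grow (suc j) = proj₁ (grow j) ∷ʳ proj₂ (grow j) , next j (proj₁ (grow j)) (proj₂ (grow j))

    ρ : Play G
    ρ j = proj₂ (grow j)

    history : ∀ j → proj₁ (grow j) ≡ before {G} ρ j
    history zero    = refl
    history (suc j) = trans (cong (_∷ʳ ρ j) (history j)) (sym (map-upTo-suc ρ j))

    agrees : ∀ j → j ≤ K → ρ j ≡ f j
    agrees zero    _   = refl
    agrees (suc j) j<K with j <? K
    ... | yes _   = refl
    ... | no j≮K = ⊥-elim (j≮K j<K)

    steps : ∀ j → ConsistentStep G σ ρ j
    steps j = steps-by (j <? K)
      where
      steps-by : Dec (j < K) → ConsistentStep G σ ρ j
      steps-by (yes j<K) =
        ConsistentStep-cong j (λ l l≤1+j → sym (agrees l (ℕP.≤-trans l≤1+j j<K))) (prefix j j<K)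
      steps-by (no j≮K) = subst (ConsistentMove G σ (before {G} ρ j) (ρ j)) (sym follows-respond)
                                (respond-consistent (before {G} ρ j) (ρ j))
        where
        follows-respond : ρ (suc j) ≡ proj₁ (respond (before {G} ρ j) (ρ j))
        follows-respond = trans (next-≮ _ _ j≮K) (cong (λ h → proj₁ (respond h (ρ j))) (history j))

module ProductGame (G : Game) (U : ℕ) where
  open Product G U

  Counter : Set
  Counter = Maybe (Fin (suc U))

  embed : State G → Counter → State'
  embed u (just c) = pair u c
  embed u nothing  = sink

  counter : ℤ → Counter
  counter (+ k) with k ≤? U
  ... | yes k≤U = just (fromℕ< (s≤s k≤U))
  ... | no _    = nothing
  counter -[1+ k ] = nothing

  update : Counter → State G → State G → Counter
  update (just c) u v = counter (+ toℕ c ℤ.+ w G u v)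
  update nothing  u v = nothing

  toℕ≤U : (c : Fin (suc U)) → toℕ c ≤ U
  toℕ≤U c = ℕP.≤-pred (toℕ<n c)

  toℕ-InRange : (c : Fin (suc U)) → InRange (+ toℕ c)
  toℕ-InRange c = ℤ.+≤+ z≤n , ℤ.+≤+ (toℕ≤U c)

  counter≡just⇒ : ∀ {x c} → counter x ≡ just c → + toℕ c ≡ x
  counter≡just⇒ {+ k} eq with k ≤? U
  counter≡just⇒ {+ k} refl | yes k≤U = cong +_ (toℕ-fromℕ< (s≤s k≤U))

  counter≡nothing⇒¬InRange : ∀ {x} → counter x ≡ nothing → ¬ InRange x
  counter≡nothing⇒¬InRange {+ k} eq (_ , k≤U) with k ≤? U
  ... | no k≰U = k≰U (ℤP.drop‿+≤+ k≤U)

  counter-step-bounded : ∀ (c d : Fin (suc U)) x → + toℕ d ≡ + toℕ c ℤ.+ x → ∣ x ∣ ≤ U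
  counter-step-bounded c d x d≡c+x = subst (λ z → ∣ z ∣ ≤ U) (sym x≡d-c)
    (ℕP.≤-trans (ℤP.∣m⊝n∣≤m⊔n (toℕ d) (toℕ c)) (ℕP.⊔-lub (toℕ≤U d) (toℕ≤U c)))
    where
    cancel : ∀ a x → x ≡ (a ℤ.+ x) ℤ.- a
    cancel = ℤ-Ring.solve-∀
    x≡d-c : x ≡ toℕ d ℤ.⊖ toℕ c
    x≡d-c = trans (cancel (+ toℕ c) x)
                  (trans (cong (ℤ._- + toℕ c) (sym d≡c+x)) (ℤP.[+m]-[+n]≡m⊖n (toℕ d) (toℕ c)))

  counter-toℕ : (c : Fin (suc U)) → counter (+ toℕ c) ≡ just c
  counter-toℕ c with toℕ c ≤? U
  ... | yes c≤U = cong just (fromℕ<-toℕ c (s≤s c≤U))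
  ... | no c≰U  = ⊥-elim (c≰U (toℕ≤U c))

  ¬InRange⇒counter≡nothing : ∀ {x} → ¬ InRange x → counter x ≡ nothing
  ¬InRange⇒counter≡nothing {+ k} out with k ≤? U
  ... | yes k≤U = ⊥-elim (out (ℤ.+≤+ z≤n , ℤ.+≤+ k≤U))
  ... | no _    = refl
  ¬InRange⇒counter≡nothing { -[1+ k ]} out = refl

  pair≢sink : ∀ u c → pair u c ≢ sink
  pair≢sink (inj₁ s) c ()
  pair≢sink (inj₂ s) c ()

  pair-injective : ∀ {u u' c c'} → pair u c ≡ pair u' c' → u ≡ u' × c ≡ c'
  pair-injective {inj₁ s} {inj₁ .s} refl = refl , refl
  pair-injective {inj₂ s} {inj₂ .s} refl = refl , refl

  w'-pair : ∀ u v c d → w' (pair u c) (pair v d) ≡ w G u v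
  w'-pair (inj₁ u) (inj₁ v) c d = refl
  w'-pair (inj₁ u) (inj₂ v) c d = refl
  w'-pair (inj₂ u) (inj₁ v) c d = refl
  w'-pair (inj₂ u) (inj₂ v) c d = refl

  w'-sink : ∀ u c → w' (pair u c) sink ≡ + 1
  w'-sink (inj₁ u) c = refl
  w'-sink (inj₂ u) c = refl

  edge-lift : ∀ m {u v} → E G u v → E' (embed u m) (embed v (update m u v))
  edge-lift nothing          e = loop
  edge-lift (just c) {u} {v} e with counter (+ toℕ c ℤ.+ w G u v) in eq
  ... | just d  = step c d e (counter≡just⇒ eq)
  ... | nothing = toSink c e (counter≡nothing⇒¬InRange eq)

  edge-view : ∀ {x y} → E' x y → ∀ {u c} → x ≡ pair u c →
              Σ (State G) λ v → E G u v × y ≡ embed v (update (just c) u v)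
  edge-view (step c d e d≡c+w) eq with pair-injective eq
  ... | refl , refl = _ , e , cong (embed _) (sym (trans (cong counter (sym d≡c+w)) (counter-toℕ d)))
  edge-view (toSink c e out) eq with pair-injective eq
  ... | refl , refl = _ , e , cong (embed _) (sym (¬InRange⇒counter≡nothing out))
  edge-view loop {u} {c} eq = ⊥-elim (pair≢sink u c (sym eq))

  sink-absorbing : ∀ {x y} → E' x y → x ≡ sink → y ≡ sink
  sink-absorbing (step {u} c _ _ _) eq = ⊥-elim (pair≢sink u c eq)
  sink-absorbing (toSink {u} c _ _) eq = ⊥-elim (pair≢sink u c eq)
  sink-absorbing loop               _  = refl

  EL-embed : ∀ {π' : Play G'} {π : Play G} (c : ℕ → Fin (suc U)) →
             (∀ i → π' i ≡ pair (π i) (c i)) → ∀ n → EL G' π' n ≡ EL G π n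
  EL-embed c π'≡ zero    = refl
  EL-embed {π'} {π} c π'≡ (suc n) = cong₂ ℤ._+_ (EL-embed c π'≡ n)
    (trans (cong₂ w' (π'≡ n) (π'≡ (suc n))) (w'-pair (π n) (π (suc n)) (c n) (c (suc n))))

  State'↔ : State' ↔ ((State G × Fin (suc U)) ⊎ ⊤)
  State'↔ = mk↔ₛ′ to from to∘from from∘to
    where
    to : State' → (State G × Fin (suc U)) ⊎ ⊤
    to (inj₁ (inj₁ (s , c))) = inj₁ (inj₁ s , c)
    to (inj₁ (inj₂ tt))      = inj₂ tt
    to (inj₂ (s , c))        = inj₁ (inj₂ s , c)
    from : (State G × Fin (suc U)) ⊎ ⊤ → State'
    from (inj₁ (u , c)) = pair u c
    from (inj₂ tt)      = sink
    to∘from : ∀ y → to (from y) ≡ y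
    to∘from (inj₁ (inj₁ s , c)) = refl
    to∘from (inj₁ (inj₂ s , c)) = refl
    to∘from (inj₂ tt)           = refl
    from∘to : ∀ x → from (to x) ≡ x
    from∘to (inj₁ (inj₁ (s , c))) = refl
    from∘to (inj₁ (inj₂ tt))      = refl
    from∘to (inj₂ (s , c))        = refl

  State'↔Fin : ∀ {n} → State G ↔ Fin n → State' ↔ Fin (suc U * n + 1)
  State'↔Fin {n} S↔n = subst (λ k → State' ↔ Fin (k + 1)) (ℕP.*-comm n (suc U))
    (↔-trans State'↔ (↔-trans ((S↔n ×-↔ ↔-refl) ⊎-↔ ↔-sym 1↔⊤)
      (↔-trans (↔-sym *↔× ⊎-↔ ↔-refl) (↔-sym +↔⊎))))

  w'-bounded : ∀ {W} → IsLargestAbsWeight G W → ∀ x y → E' x y → ∣ w' x y ∣ ≤ (W ⊓ U) ⊔ 1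
  w'-bounded (w≤W , _) _ _ (step {u} {v} c d e d≡c+w) =
    subst (λ z → ∣ z ∣ ≤ _) (sym (w'-pair u v c d))
      (ℕP.≤-trans (ℕP.⊓-glb (w≤W u v e) (counter-step-bounded c d (w G u v) d≡c+w)) (ℕP.m≤m⊔n _ 1))
  w'-bounded _ _ _ (toSink {u} c e _) = subst (λ z → ∣ z ∣ ≤ _) (sym (w'-sink u c)) (ℕP.m≤n⊔m _ 1)
  w'-bounded _ _ _ loop = ℕP.m≤n⊔m _ 1

-- From G to G'

module Forward (G : Game) (U : ℕ) (t : ℚ) (sinit : State G) where
  open Product G U
  open ProductGame G U

  forget : State' → State G
  forget (inj₁ (inj₁ (s , _))) = inj₁ s
  forget (inj₁ (inj₂ tt))      = sinit   -- arbitrary: the plays considered never reach the sink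
  forget (inj₂ (s , _))        = inj₂ s

  forget-pair : ∀ u c → forget (pair u c) ≡ u
  forget-pair (inj₁ s) c = refl
  forget-pair (inj₂ s) c = refl

  lift-strategy : Strategy₁ G → Strategy₁ G'
  lift-strategy σ h (inj₁ (s , c)) =
    embed (proj₁ move) (update (just c) (inj₁ s) (proj₁ move)) , edge-lift (just c) (proj₂ move)
    where
    move : Σ (State G) (E G (inj₁ s))
    move = σ (map forget h) s
  lift-strategy σ h (inj₂ tt) = sink , loop

  module _ (σ : Strategy₁ G)
           (win : ∀ π → IsPlayFrom G sinit π → ConsistentWith G σ π →
                  (_∩_ {G} (LowerUpper G U 0ℤ) (AvgEnergy G t)) π)
           (π' : Play G') (play' : IsPlayFrom G' (pair sinit zero) π')
           (consistent' : ConsistentWith G' (lift-strategy σ) π') where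

    π : Play G
    π i = forget (π' i)

    π₀ : π 0 ≡ sinit
    π₀ = trans (cong forget (proj₁ play')) (forget-pair sinit zero)

    Prefix : ℕ → Set
    Prefix i = ∀ j → j < i → ConsistentStep G σ π j

    Tracks : ℕ → Set
    Tracks i = Σ (Fin (suc U)) λ c → (π' i ≡ pair (π i) c) × (+ toℕ c ≡ EL G π i)

    next-move : ∀ i {u c} → π' i ≡ pair u c →
                Σ (State G) λ v → ConsistentMove G σ (before {G} π i) u v ×
                                  (π' (suc i) ≡ embed v (update (just c) u v))
    next-move i {inj₁ s} {c} π'≡ = proj₁ move , (proj₂ move , λ { _ refl → refl }) ,
      trans (consistent' i (inj₁ (s , c)) π'≡)
            (cong (λ h → embed (proj₁ (σ h s)) (update (just c) (inj₁ s) (proj₁ (σ h s))))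
                  (sym (ListP.map-∘ (upTo i))))
      where
      move : Σ (State G) (E G (inj₁ s))
      move = σ (before {G} π i) s
    next-move i {inj₂ s} {c} π'≡ with edge-view (subst (λ x → E' x (π' (suc i))) π'≡ (proj₂ play' i)) refl
    ... | v , e , π'₊≡ = v , (e , λ _ ()) , π'₊≡

    -- The prefix followed by v extends to a full σ-consistent play, which satisfies LowerUpper.
    in-range : ∀ i → Prefix i → ∀ v → ConsistentMove G σ (before {G} π i) (π i) v →
               InRange (EL G π i ℤ.+ w G (π i) v)
    in-range i prefix v move =
      subst InRange EL-ρ≡ (subst InRange (ℤP.+-identityˡ _) (proj₁ (uncurry (win ρ) ρ-play×consistent) (suc i)))
      where
      f : Play G
      f = splice π i v
      f≗π : ∀ j → j ≤ i → f j ≡ π j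
      f≗π j = splice-≤ π v
      f-prefix : ∀ j → j < suc i → ConsistentStep G σ f j
      f-prefix = extend-below
        (λ j j<i → ConsistentStep-cong {G} {σ} j (λ l l≤1+j → sym (f≗π l (ℕP.≤-trans l≤1+j j<i)))
                                                  (prefix j j<i))
        (ConsistentMove-cong {G} {σ} (sym (map-upTo-cong i (λ l l<i → f≗π l (ℕP.<⇒≤ l<i))))
                             (sym (f≗π i ℕP.≤-refl)) (sym (splice-suc π i v)) move)
      extension : Σ (Play G) λ ρ → (∀ j → j ≤ suc i → ρ j ≡ f j) × (∀ j → ConsistentStep G σ ρ j)
      extension = extend-prefix {G} {σ} f (suc i) f-prefix
      ρ : Play G
      ρ = proj₁ extension
      ρ≗f : ∀ j → j ≤ suc i → ρ j ≡ f j
      ρ≗f = proj₁ (proj₂ extension)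
      ρ-play×consistent : IsPlayFrom G sinit ρ × ConsistentWith G σ ρ
      ρ-play×consistent =
        consistent-play {G} {σ} (trans (ρ≗f 0 z≤n) (trans (f≗π 0 z≤n) π₀)) (proj₂ (proj₂ extension))
      EL-ρ≡ : EL G ρ (suc i) ≡ EL G π i ℤ.+ w G (π i) v
      EL-ρ≡ = begin
        EL G ρ (suc i)                         ≡⟨ EL-cong G (suc i) ρ≗f ⟩
        EL G f i ℤ.+ w G (f i) (f (suc i))     ≡⟨ cong₂ ℤ._+_ (EL-cong G i f≗π)
                                                           (cong₂ (w G) (f≗π i ℕP.≤-refl) (splice-suc π i v)) ⟩
        EL G π i ℤ.+ w G (π i) v               ∎
        where open ≡-Reasoning

    tracking : ∀ i → Tracks i × Prefix i
    tracking zero = (zero , trans (proj₁ play') (cong (λ u → pair u zero) (sym π₀)) , refl) , λ _ ()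
    tracking (suc i) with tracking i
    ... | (c , π'≡ , c≡EL) , prefix with next-move i π'≡
    ...   | v , move , π'₊≡ with counter (+ toℕ c ℤ.+ w G (π i) v) in counter≡
    ...     | nothing = ⊥-elim (counter≡nothing⇒¬InRange counter≡
                          (subst (λ x → InRange (x ℤ.+ w G (π i) v)) (sym c≡EL) (in-range i prefix v move)))
    ...     | just d  = (d , trans π'₊≡ (cong (λ u → pair u d) (sym π₊≡v)) , d≡EL) ,
                        extend-below prefix (subst (ConsistentMove G σ (before {G} π i) (π i)) (sym π₊≡v) move)
      where
      π₊≡v : π (suc i) ≡ v
      π₊≡v = trans (cong forget π'₊≡) (forget-pair v d)
      d≡EL : + toℕ d ≡ EL G π (suc i)
      d≡EL = trans (counter≡just⇒ counter≡) (cong₂ ℤ._+_ c≡EL (cong (w G (π i)) (sym π₊≡v)))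

    lift-strategy-wins : AvgEnergy G' t π'
    lift-strategy-wins = AvgEnergy-cong t (λ n → sym (EL-embed counters π'≡ n)) (proj₂ (uncurry (win π) π-play))
      where
      counters : ℕ → Fin (suc U)
      counters i = proj₁ (proj₁ (tracking i))
      π'≡ : ∀ i → π' i ≡ pair (π i) (counters i)
      π'≡ i = proj₁ (proj₂ (proj₁ (tracking i)))
      π-play : IsPlayFrom G sinit π × ConsistentWith G σ π
      π-play = consistent-play {G} {σ} π₀ (λ j → proj₂ (tracking (suc j)) j ℕP.≤-refl)

-- From G' to G

module Backward (G : Game) (U : ℕ) (t : ℚ) (sinit : State G) where
  open Product G U
  open ProductGame G U

  -- the lift of the states before the last one read, the last state read, and its counter
  Trace : Set
  Trace = List State' × State G × Counter

  read : Maybe Trace → State G → Trace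
  read nothing               v = [] , v , just zero
  read (just (L , u , m)) v = L ∷ʳ embed u m , v , update m u v

  trace : List (State G) → Maybe Trace
  trace = foldl (λ τ u → just (read τ u)) nothing

  module _ (σ' : Strategy₁ G')
           (win' : ∀ π' → IsPlayFrom G' (pair sinit zero) π' → ConsistentWith G' σ' π' →
                   AvgEnergy G' t π') where

    answer : List State' → Counter → (s : S₁ G) → Σ (State G) (E G (inj₁ s))
    answer L (just c) s with edge-view (proj₂ (σ' L (inj₁ (s , c)))) refl
    ... | v , e , _ = v , e
    answer L nothing s = total G (inj₁ s)

    project-strategy : Strategy₁ G
    project-strategy h s = answer (proj₁ τ) (proj₂ (proj₂ τ)) s
      where
      τ : Trace
      τ = read (trace h) (inj₁ s)

    lift-move : ∀ m u v L → (∀ s → u ≡ inj₁ s → v ≡ proj₁ (answer L m s)) →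
                ∀ x → embed u m ≡ inj₁ x → embed v (update m u v) ≡ proj₁ (σ' L x)
    lift-move nothing u v L _ .(inj₂ tt) refl = sym (sink-absorbing (proj₂ (σ' L (inj₂ tt))) refl)
    lift-move (just c) (inj₁ s) v L follows .(inj₁ (s , c)) refl
      with edge-view (proj₂ (σ' L (inj₁ (s , c)))) refl | follows s refl
    ... | v' , _ , σ'≡ | refl = sym σ'≡

    module _ (π : Play G) (play : IsPlayFrom G sinit π)
             (consistent : ConsistentWith G project-strategy π) where

      count : ℕ → Counter
      count zero    = just zero
      count (suc i) = update (count i) (π i) (π (suc i))

      π' : Play G'
      π' i = embed (π i) (count i)

      trace-before : ∀ i → read (trace (before {G} π i)) (π i) ≡ (before {G'} π' i , π i , count i)
      trace-before zero    = refl
      trace-before (suc i) = begin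
        read (trace (map π (upTo (suc i)))) (π (suc i))
          ≡⟨ cong (λ h → read (trace h) (π (suc i))) (map-upTo-suc π i) ⟩
        read (trace (map π (upTo i) ∷ʳ π i)) (π (suc i))
          ≡⟨ cong (λ τ → read τ (π (suc i))) (ListP.foldl-∷ʳ _ nothing (π i) (map π (upTo i))) ⟩
        read (just (read (trace (map π (upTo i))) (π i))) (π (suc i))
          ≡⟨ cong (λ τ → read (just τ) (π (suc i))) (trace-before i) ⟩
        (map π' (upTo i) ∷ʳ π' i , π (suc i) , count (suc i))
          ≡⟨ cong (_, π (suc i) , count (suc i)) (map-upTo-suc π' i) ⟨
        (map π' (upTo (suc i)) , π (suc i) , count (suc i))
          ∎
        where open ≡-Reasoning

      π'-play : IsPlayFrom G' (pair sinit zero) π'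
      π'-play = cong (λ u → pair u zero) (proj₁ play) , λ i → edge-lift (count i) (proj₂ play i)

      π'-consistent : ConsistentWith G' σ' π'
      π'-consistent i = lift-move (count i) (π i) (π (suc i)) (before {G'} π' i) follows
        where
        follows : ∀ s → π i ≡ inj₁ s → π (suc i) ≡ proj₁ (answer (before {G'} π' i) (count i) s)
        follows s π≡s = trans (consistent i s π≡s)
          (cong (λ τ → proj₁ (answer (proj₁ τ) (proj₂ (proj₂ τ)) s))
                (subst (λ u → read (trace (before {G} π i)) u ≡ (before {G'} π' i , π i , count i))
                       π≡s (trace-before i)))

      -- Once in the sink, the energy grows by one per step, so the average energy diverges.
      count≢nothing : ∀ k → count k ≢ nothing
      count≢nothing k sunk = EL-increasing⇒¬AvgEnergy G' π' t k increasing (win' π' π'-play π'-consistent)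
        where
        next-sunk : ∀ j → count (k + j) ≡ nothing → count (suc (k + j)) ≡ nothing
        next-sunk j sunk-at = cong (λ m → update m (π (k + j)) (π (suc (k + j)))) sunk-at
        stays-sunk : ∀ j → count (k + j) ≡ nothing
        stays-sunk zero    = trans (cong count (ℕP.+-identityʳ k)) sunk
        stays-sunk (suc j) = trans (cong count (ℕP.+-suc k j)) (next-sunk j (stays-sunk j))
        increasing : ∀ j → EL G' π' (k + j) ℤ.+ 1ℤ ℤ.≤ EL G' π' (suc (k + j))
        increasing j = ℤP.≤-reflexive (cong (λ z → EL G' π' (k + j) ℤ.+ z)
          (sym (cong₂ w' (cong (embed _) (stays-sunk j)) (cong (embed _) (next-sunk j (stays-sunk j))))))

      count-suc : ∀ {i c} → count i ≡ just c → count (suc i) ≡ update (just c) (π i) (π (suc i))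
      count-suc {i} count≡ = cong (λ m → update m (π i) (π (suc i))) count≡

      tracking : ∀ i → Σ (Fin (suc U)) λ c → (count i ≡ just c) × (+ toℕ c ≡ EL G π i)
      tracking zero = zero , refl , refl
      tracking (suc i) with tracking i
      ... | c , count≡ , c≡EL with counter (+ toℕ c ℤ.+ w G (π i) (π (suc i))) in counter≡
      ...   | just d  = d , trans (count-suc count≡) counter≡ ,
                        trans (counter≡just⇒ counter≡) (cong (ℤ._+ w G (π i) (π (suc i))) c≡EL)
      ...   | nothing = ⊥-elim (count≢nothing (suc i) (trans (count-suc count≡) counter≡))

      project-strategy-wins : (_∩_ {G} (LowerUpper G U 0ℤ) (AvgEnergy G t)) π
      project-strategy-wins = (λ n → subst InRange (sym (ℤP.+-identityˡ (EL G π n)))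
                      (subst InRange (proj₂ (proj₂ (tracking n))) (toℕ-InRange (proj₁ (tracking n))))) ,
             AvgEnergy-cong t (EL-embed (λ i → proj₁ (tracking i))
                                        (λ i → cong (embed (π i)) (proj₁ (proj₂ (tracking i)))))
                            (win' π' π'-play π'-consistent)

lemma6 : (G : Game) (n W U : ℕ) (t : ℚ) (sinit : State G) →
         (State G ↔ Fin n) →
         IsLargestAbsWeight G W →
         let open Product G U in
         (State G' ↔ Fin (suc U * n + 1)) ×
         (∀ x y → E G' x y → ∣ w G' x y ∣ ≤ (W ⊓ U) ⊔ 1) ×
         (WinsFrom G sinit (_∩_ {G} (LowerUpper G U 0ℤ) (AvgEnergy G t))
            ⇔ WinsFrom G' (pair sinit zero) (AvgEnergy G' t))
lemma6 G n W U t sinit S↔n largest =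
  State'↔Fin S↔n , w'-bounded largest ,
  mk⇔ (λ (σ , win) → lift-strategy σ , lift-strategy-wins σ win)
      (λ (σ' , win') → project-strategy σ' win' , project-strategy-wins σ' win')
  where
  open ProductGame G U
  open Forward G U t sinit
  open Backward G U t sinit
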